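{- Let $\vec G$ be any feasible PV graph with distinct site identifiers, $k$ carriers and system period $p$, and suppose the agent is given the number $n$ of sites. Then the number of moves performed by Algorithm Hitch-a-guessing-ride to explore $\vec G$ is $O(k\cdot P)$, where $P=p$ if the graph is (known to be) homogeneous and $P=p^2$ otherwise.
   Context: A PV system consists of a finite set $S$ of $n$ sites, here with distinct identifiers, and a set $C$ of $k$ carriers; each carrier $c$ has a unique identifier and a route $\pi(c)=\langle x_0,\dots,x_{p(c)-1}\rangle$ of sites, with period $p(c)$ and $\pi(c)[j]=x_{j\bmod p(c)}$; at each time $t=0,1,\dots$ carrier $c$ moves from $\pi(c)[t]$ to $\pi(c)[t+1]$. The system period is $p=\max_c p(c)$; the graph is homogeneous if all periods are equal. Carriers $a,b$ meet at time $t$ if $\pi(a)[t]=\pi(b)[t]$. An exploring agent is placed at time $0$ at a starting site $x\in\{\pi(c)[0]\}$; at each time $t$, at site $y$, it observes the id of $y$ and the identifiers of carriers $c$ with $\pi(c)[t]=y$, and either halts or moves with one such carrier to $\pi(c)[t+1]$ (one move); "riding with $c$" means repeatedly choosing $c$, and the agent may switch to a carrier it meets. The PV graph is feasible if from every starting site some finite sequence of moves visits all sites. Algorithm Hitch-a-guessing-ride: the agent keeps a set Visited of sites it has been at (never reset), a current guess $g$ (initially a fixed positive constant $g_0$), a Home carrier (initially a carrier present at the start site), parent pointers (Home has none) and a set Encountered of carriers (initially $\{\text{Home}\}$). Procedure on carrier $c$: if $|\text{Visited}|=n$, halt. Otherwise ride with $c$ for up to $g$ time units, adding each site reached to Visited;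 if during this ride it meets a carrier $c'\notin$ Encountered, it adds $c'$ to Encountered, sets $\mathrm{parent}(c')=c$, switches to $c'$ and runs the procedure on $c'$. If the $g$ time units elapse without this happening: if $c$ is the Home, it halts when $|\text{Visited}|=n$ and otherwise restarts; if $c$ is not the Home, it backtracks, riding with $c$ (adding sites to Visited) until it meets $\mathrm{parent}(c)$, but if during this ride it meets a carrier not in Encountered or $g$ time units elapse, it restarts; otherwise it switches to $\mathrm{parent}(c)$ and runs the procedure on it. Restart (on the current carrier $c$): set $g:=2g$, Home $:=c$ with no parent, Encountered $:=\{c\}$ (Visited is kept), and run the procedure on $c$. The constant in $O(\cdot)$ does not depend on the graph (it depends only on the fixed initial guess $g_0$). -}

module Defs where

open import Data.Nat using (ℕ; zero; suc; _+_; _*_; _⊔_; _≤_; NonZero)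
open import Data.Nat.DivMod using (_mod_)
open import Data.Fin using (Fin)
open import Data.Fin.Properties using () renaming (_≟_ to _≟ᶠ_)
open import Data.Fin.Subset using (Subset; _∈_; _∉_; ⁅_⁆; _∪_; ∣_∣; Nonempty; ⊥)
open import Data.Fin.Subset.Properties using (nonempty?; _∈?_)
open import Data.Bool using (Bool; true; false; _∧_; not; if_then_else_)
open import Data.Maybe using (Maybe; just; nothing)
open import Data.List using (List; []; _∷_; foldr; map; allFin)
open import Data.List.Membership.Propositional using () renaming (_∈_ to _∈ˡ_)
open import Data.Vec using (tabulate)
open import Data.Product using (Σ; ∃; ∃-syntax; _×_; _,_)
open import Data.Unit using (⊤)
open import Function using (_∘_)
open import Relation.Nullary using (yes; no; ⌊_⌋)
open import Relation.Binary.PropositionalEquality using (_≡_)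
open import Data.Nat.Properties using () renaming (_≟_ to _≟ⁿ_)

-- PV graphs: sites are Fin n (distinct identifiers), carriers are Fin k
-- (distinct identifiers).

record PVGraph (n k : ℕ) : Set where
  field
    period    : Fin k → ℕ
    period-nz : (c : Fin k) → NonZero (period c)
    route     : (c : Fin k) → Fin (period c) → Fin n

  pos : Fin k → ℕ → Fin n
  pos c t = route c ((t mod period c) {{period-nz c}})

open PVGraph public

sysPeriod : ∀ {n k} → PVGraph n k → ℕ
sysPeriod {k = k} G = foldr _⊔_ 0 (map (period G) (allFin k))

Homogeneous : ∀ {n k} → PVGraph n k → Set
Homogeneous G = ∀ c c' → period G c ≡ period G c'

ValidMoves : ∀ {n k} → PVGraph n k → Fin n → ℕ → List (Fin k) → Set
ValidMoves G y t []       = ⊤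
ValidMoves G y t (c ∷ cs) = pos G c t ≡ y × ValidMoves G (pos G c (suc t)) (suc t) cs

visits : ∀ {n k} → PVGraph n k → Fin n → ℕ → List (Fin k) → List (Fin n)
visits G y t []       = y ∷ []
visits G y t (c ∷ cs) = y ∷ visits G (pos G c (suc t)) (suc t) cs

Feasible : ∀ {n k} → PVGraph n k → Set
Feasible {n} {k} G = (c₀ : Fin k) →
  ∃[ cs ] (ValidMoves G (pos G c₀ 0) 0 cs × ((y : Fin n) → y ∈ˡ visits G (pos G c₀ 0) 0 cs))

-- Tie-breaking: when several not-yet-encountered carriers are met at the
-- same time, the agent switches to one of them chosen by a selection rule.

Pick : ℕ → Set
Pick k = (S : Subset k) → Nonempty S → Fin k

PickCorrect : ∀ {k} → Pick k → Set
PickCorrect {k} pick = (S : Subset k) (ne : Nonempty S) → pick S ne ∈ S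

data Mode : Set where
  procedure : Mode
  explore   : ℕ → Mode      -- riding forward, remaining time units of the guess
  backtrack : ℕ → Mode      -- riding back towards the parent, remaining time units
  halted    : Mode

record AgentState (n k : ℕ) : Set where
  field
    time        : ℕ
    cur         : Fin k                 -- carrier the agent is on
    guess       : ℕ
    home        : Fin k
    parent      : Fin k → Maybe (Fin k)
    encountered : Subset k
    visited     : Subset n
    mode        : Mode
    moves       : ℕ

open AgentState public

module _ {n k : ℕ} (G : PVGraph n k) (pick : Pick k) where

  newCarriers : AgentState n k → Subset k
  newCarriers s = tabulate λ c' →
    ⌊ pos G c' (time s) ≟ᶠ pos G (cur s) (time s) ⌋ ∧ not ⌊ c' ∈? encountered s ⌋

  allVisited : AgentState n k → Bool
  allVisited s = ⌊ ∣ visited s ∣ ≟ⁿ n ⌋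

  restart : AgentState n k → AgentState n k
  restart s = record s
    { guess = 2 * guess s ; home = cur s ; parent = λ _ → nothing
    ; encountered = ⁅ cur s ⁆ ; mode = procedure }

  moveOn : AgentState n k → Mode → AgentState n k
  moveOn s m = record s
    { time = suc (time s) ; moves = suc (moves s)
    ; visited = visited s ∪ ⁅ pos G (cur s) (suc (time s)) ⁆ ; mode = m }

  switchNew : AgentState n k → Fin k → AgentState n k
  switchNew s c' = record s
    { encountered = encountered s ∪ ⁅ c' ⁆
    ; parent = λ d → if ⌊ d ≟ᶠ c' ⌋ then just (cur s) else parent s d
    ; cur = c' ; mode = procedure }

  step : AgentState n k → AgentState n k
  step s with mode s
  ... | halted = s
  ... | procedure = if allVisited s then record s { mode = halted }
                                    else record s { mode = explore (guess s) }
  ... | explore r with nonempty? (newCarriers s)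
  ...   | yes ne = switchNew s (pick (newCarriers s) ne)
  ...   | no _ with r
  ...     | suc r' = moveOn s (explore r')
  ...     | zero = if ⌊ cur s ≟ᶠ home s ⌋
                     then (if allVisited s then record s { mode = halted } else restart s)
                     else record s { mode = backtrack (guess s) }
  step s | backtrack r with nonempty? (newCarriers s)
  ...   | yes _ = restart s
  ...   | no _ with parent s (cur s)
  ...     | just q with pos G q (time s) ≟ᶠ pos G (cur s) (time s)
  ...       | yes _ = record s { cur = q ; mode = procedure }
  ...       | no _ with r
  ...         | suc r' = moveOn s (backtrack r')
  ...         | zero = restart s
  step s | backtrack r | no _ | nothing with r
  ...         | suc r' = moveOn s (backtrack r')
  ...         | zero = restart s

  initial : ℕ → Fin k → AgentState n k
  initial g₀ h = record
    { time = 0 ; cur = h ; guess = g₀ ; home = h ; parent = λ _ → nothing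
    ; encountered = ⁅ h ⁆ ; visited = ⁅ pos G h 0 ⁆ ; mode = procedure ; moves = 0 }

  run : ℕ → AgentState n k → AgentState n k
  run zero    s = s
  run (suc m) s = run m (step s)

IsHalted : ∀ {n k} → AgentState n k → Set
IsHalted s = mode s ≡ halted

-- P = p if homogeneous, p² otherwise.  Stated as: the bound C·k·P holds,
-- where P is p for homogeneous graphs and p² for arbitrary graphs.

module Submission where

-- Call L a meeting window of G when every two carriers have a common multiple
-- of their periods in [1, L].  Then two carriers that meet once meet in every
-- time interval of length L, and a carrier passes every site of its route in
-- every such interval.  The number p² is always a meeting window, and p is one
-- for homogeneous graphs.  For a fixed window L (module Exploration) we show an
-- invariant of the algorithm's state after i steps:
--   * the Encountered carriers form a tree rooted at Home (parent pointers),
--     each tree edge joining two carriers that meet;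
--   * a potential inequality: with W = 2g+3, the cost of exploring and
--     backtracking one tree edge, i + W·depth(cur) + 2W + 15kg₀ is at most
--     15kg + 2W·|Encountered| + (slack of the current ride); in particular
--     i < 15k·2g;
--   * once g ≥ L, every encountered carrier that is not an ancestor of the
--     current one is explored (its route visited, its partners encountered).
-- The last point shows that a phase with g ≥ L ends with all sites visited, so
-- g never exceeds g₀ + 2L and the run halts within 15k·2(g₀+2L) ≤ 30(g₀+2)kL
-- steps; moves never exceed steps.  The theorem takes L = p², and L = p for
-- homogeneous graphs; as the halted state is unique, both bounds hold at once.

open import Defs
open import Data.Bool using (true; false; _∧_; not; if_then_else_)
open import Data.Empty using (⊥; ⊥-elim)
open import Data.Fin using (Fin) renaming (_≟_ to _≟ᶠ_)
open import Data.Fin.Properties using (fromℕ<-cong; toℕ<n)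
open import Data.Fin.Subset using (Subset; _∈_; _∉_; ⁅_⁆; _∪_; ∣_∣; Nonempty; _⊆_; ⊤)
open import Data.Fin.Subset.Properties
  using ( nonempty?; _∈?_; p⊆p∪q; q⊆p∪q; x∈p∪q⁻; x∈⁅x⁆; x∈⁅y⁆⇒x≡y; ∣⁅x⁆∣≡1; ∣p∣≤n
        ; p⊂q⇒∣p∣<∣q∣; ⊆-antisym; ⊆⊤; ∣⊤∣≡n)
open import Data.List using (List; []; _∷_; foldr; map; allFin)
open import Data.List.Membership.Propositional using () renaming (_∈_ to _∈ˡ_)
open import Data.List.Membership.Propositional.Properties using (∈-allFin)
open import Data.List.Relation.Unary.Any using (here; there)
open import Data.Maybe using (Maybe; just; nothing)
open import Data.Maybe.Properties using (just-injective)
open import Data.Nat using (ℕ; zero; suc; _+_; _*_; _∸_; _⊔_; _≤_; _<_; z≤n; s≤s; >-nonZero⁻¹)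
open import Data.Nat.DivMod using (_%_; _/_; m≡m%n+[m/n]*n; m%n<n; [m+kn]%n≡m%n)
open import Data.Nat.Divisibility using (_∣_; divides; m∣m*n; n∣m*n; ∣-reflexive)
open import Data.Nat.Properties
open import Data.Nat.Tactic.RingSolver using (solve-∀)
open import Data.Product using (∃-syntax; _×_; _,_; proj₁; proj₂)
open import Data.Sum using (_⊎_; inj₁; inj₂)
open import Data.Vec.Properties using ([]=⇒lookup; lookup⇒[]=; lookup∘tabulate)
open import Relation.Nullary using (¬_; yes; no; ⌊_⌋)
open import Relation.Binary.PropositionalEquality

-- Arithmetic of the potential.  Throughout, W stands for 2g+3 and the
-- inequalities have the shape  steps + W·depth + B + K ≤ Z + 2W·e + slack.

-- One step of riding: the step counter and the slack both grow by one.
budget-tick : ∀ {a b x x'} → a ≤ b + x → suc x ≤ x' → suc a ≤ b + x'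
budget-tick {a} {b} {x} {x'} le sx =
  ≤-trans (s≤s le) (subst (_≤ b + x') (+-suc b x) (+-monoʳ-≤ b sx))

-- Switching to a new carrier: the depth grows by one (cost W), a carrier is
-- added to Encountered (credit 2W), and the ride's slack x (≤ W - 1) is dropped.
budget-descend : ∀ {A D D' B Kv Z e e' x W} → A + W * D + B + Kv ≤ Z + 2 * W * e + x →
  D' ≡ suc D → x + suc W ≤ 2 * W → suc e ≤ e' → suc A + W * D' + B + Kv ≤ Z + 2 * W * e' + 0
budget-descend {A} {D} {_} {B} {Kv} {Z} {e} {e'} {x} {W} le refl xw ee = begin
  suc A + W * suc D + B + Kv  ≡⟨ shift W A D B Kv ⟩
  A + W * D + B + Kv + suc W  ≤⟨ +-monoˡ-≤ (suc W) le ⟩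
  Z + 2 * W * e + x + suc W   ≡⟨ +-assoc (Z + 2 * W * e) x (suc W) ⟩
  Z + 2 * W * e + (x + suc W) ≤⟨ +-monoʳ-≤ (Z + 2 * W * e) xw ⟩
  Z + 2 * W * e + 2 * W       ≡⟨ collect W Z e ⟩
  Z + 2 * W * suc e           ≤⟨ +-monoʳ-≤ Z (*-monoʳ-≤ (2 * W) ee) ⟩
  Z + 2 * W * e'              ≡⟨ sym (+-identityʳ _) ⟩
  Z + 2 * W * e' + 0          ∎
  where
  open ≤-Reasoning
  shift : ∀ W A D B Kv → suc A + W * suc D + B + Kv ≡ A + W * D + B + Kv + suc W
  shift = solve-∀
  collect : ∀ W Z e → Z + 2 * W * e + 2 * W ≡ Z + 2 * W * suc e
  collect = solve-∀

-- Returning to the parent: the depth drops by one, which frees W and pays for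
-- the backtracking slack x < W.
budget-ascend : ∀ {A D Dq B Kv Z e x W} → A + W * D + B + Kv ≤ Z + 2 * W * e + x →
  D ≡ suc Dq → suc x ≤ W → suc A + W * Dq + B + Kv ≤ Z + 2 * W * e + 0
budget-ascend {A} {_} {Dq} {B} {Kv} {Z} {e} {x} {W} le refl xw = +-cancelʳ-≤ W _ _ (begin
  suc A + W * Dq + B + Kv + W    ≡⟨ shift W A Dq B Kv ⟩
  suc (A + W * suc Dq + B + Kv)  ≤⟨ s≤s le ⟩
  suc (Z + 2 * W * e + x)        ≡⟨ sym (+-suc _ x) ⟩
  Z + 2 * W * e + suc x          ≤⟨ +-monoʳ-≤ (Z + 2 * W * e) xw ⟩
  Z + 2 * W * e + W              ≡⟨ cong (_+ W) (sym (+-identityʳ _)) ⟩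
  Z + 2 * W * e + 0 + W          ∎)
  where
  open ≤-Reasoning
  shift : ∀ W A Dq B Kv → suc A + W * Dq + B + Kv + W ≡ suc (A + W * suc Dq + B + Kv)
  shift = solve-∀

-- With at most k encountered carriers and slack at most 2g+2, the potential
-- leaves room for one more step within the doubled budget 15k·2g.
budget-exhausted : ∀ {A D B Kv e x g k} →
  A + (2 * g + 3) * D + B + Kv ≤ 15 * k * g + 2 * (2 * g + 3) * e + x →
  e ≤ k → x ≤ suc (suc (g + g)) → 1 ≤ g → 1 ≤ k → suc A + Kv ≤ 15 * k * (2 * g)
budget-exhausted {A} {D} {B} {Kv} {e} {x} {suc b} {suc a} le ek xg _ _ = begin
  suc A + Kv                                  ≤⟨ s≤s (+-monoˡ-≤ Kv (≤-trans (m≤m+n A _) (m≤m+n _ B))) ⟩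
  suc (A + W * D + B + Kv)                    ≤⟨ s≤s le ⟩
  suc (Z + 2 * W * e + x)                     ≤⟨ s≤s (+-mono-≤ (+-monoʳ-≤ Z (*-monoʳ-≤ (2 * W) ek)) xg) ⟩
  suc (Z + 2 * W * suc a + suc (suc (suc b + suc b))) ≤⟨ m≤m+n _ (5 * a + 9 * b + 11 * a * b) ⟩
  suc (Z + 2 * W * suc a + suc (suc (suc b + suc b))) + (5 * a + 9 * b + 11 * a * b) ≡⟨ doubled a b ⟩
  15 * suc a * (2 * suc b)                    ∎
  where
  open ≤-Reasoning
  W = 2 * suc b + 3
  Z = 15 * suc a * suc b
  doubled : ∀ a b → suc (15 * suc a * suc b + 2 * (2 * suc b + 3) * suc a + suc (suc (suc b + suc b)))
                      + (5 * a + 9 * b + 11 * a * b) ≡ 15 * suc a * (2 * suc b)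
  doubled = solve-∀

-- A restart starts a fresh tree (depth 0, one encountered carrier) whose
-- potential is exactly the budget already reached.
budget-restart : ∀ {A Kv Z} w → A + Kv ≤ Z → A + w * 0 + 2 * w + Kv ≤ Z + 2 * w * 1 + 0
budget-restart {A} {Kv} {Z} w le =
  subst₂ _≤_ (sym (lhs A Kv w)) (sym (rhs Z w)) (+-monoˡ-≤ (2 * w) le)
  where
  lhs : ∀ A Kv w → A + w * 0 + 2 * w + Kv ≡ A + Kv + 2 * w
  lhs = solve-∀
  rhs : ∀ Z w → Z + 2 * w * 1 + 0 ≡ Z + 2 * w
  rhs = solve-∀

-- The slack available when switching carriers after u ≤ g exploring steps.
explore-slack : ∀ {u g} → u ≤ g → suc u + suc (2 * g + 3) ≤ 2 * (2 * g + 3)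
explore-slack {u} {g} ug = ≤-trans (+-monoˡ-≤ (suc (2 * g + 3)) (s≤s ug))
  (subst (suc g + suc (2 * g + 3) ≤_) (identity g) (m≤m+n _ (suc g)))
  where
  identity : ∀ g → suc g + suc (2 * g + 3) + suc g ≡ 2 * (2 * g + 3)
  identity = solve-∀

-- The slack of a backtracking ride of u ≤ g steps after a full exploring ride.
backtrack-slack : ∀ {u g} → u ≤ g → suc (suc (suc (u + g))) ≤ 2 * g + 3
backtrack-slack {u} {g} ug =
  subst (suc (suc (suc (u + g))) ≤_) (identity g) (s≤s (s≤s (s≤s (+-monoˡ-≤ g ug))))
  where
  identity : ∀ g → suc (suc (suc (g + g))) ≡ 2 * g + 3
  identity = solve-∀

final-budget : ∀ {k g₀ L} → 1 ≤ L → 15 * k * (2 * (g₀ + 2 * L)) ≤ 30 * (g₀ + 2) * k * L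
final-budget {k} {g₀} {suc l} _ =
  subst (15 * k * (2 * (g₀ + 2 * suc l)) ≤_) (identity k g₀ l) (m≤m+n _ _)
  where
  identity : ∀ k g₀ l → 15 * k * (2 * (g₀ + 2 * suc l)) + 30 * k * g₀ * l ≡ 30 * (g₀ + 2) * k * suc l
  identity = solve-∀

pos-period : ∀ {n k} (G : PVGraph n k) c t m → pos G c (t + m * period G c) ≡ pos G c t
pos-period G c t m = cong (route G c)
  (fromℕ<-cong _ _ ([m+kn]%n≡m%n t m (period G c) {{period-nz G c}}) _ _)

pos-shift : ∀ {n k} (G : PVGraph n k) c t P → period G c ∣ P → pos G c (t + P) ≡ pos G c t
pos-shift G c t P (divides m refl) = pos-period G c t m

-- A P-periodic property of time that holds once holds somewhere in every
-- interval [T, T+P).  This turns "carriers a and b meet" into "a and b meet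
-- within any L consecutive time units".
periodic-window : (Q : ℕ → Set) (P : ℕ) → 1 ≤ P →
  (∀ t → Q t → Q (t + P)) → (∀ t → Q (t + P) → Q t) →
  ∀ t₀ → Q t₀ → ∀ T → ∃[ j ] (j < P × Q (T + j))
periodic-window Q P@(suc _) _ forward backward t₀ q T = y % P , m%n<n y P , at-residue
  where
  forwards : ∀ m t → Q t → Q (t + m * P)
  forwards zero    t q = subst Q (sym (+-identityʳ t)) q
  forwards (suc m) t q = subst Q (+-assoc t P (m * P)) (forwards m (t + P) (forward t q))
  backwards : ∀ m t → Q (t + m * P) → Q t
  backwards zero    t q = subst Q (+-identityʳ t) q
  backwards (suc m) t q = backward t (backwards m (t + P) (subst Q (sym (+-assoc t P (m * P))) q))
  x = t₀ + T * P
  y = x ∸ T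
  T≤x : T ≤ x
  T≤x = ≤-trans (m≤m*n T P) (m≤n+m (T * P) t₀)
  split : x ≡ T + y % P + y / P * P
  split = begin
    x                       ≡⟨ sym (m+[n∸m]≡n T≤x) ⟩
    T + y                   ≡⟨ cong (T +_) (m≡m%n+[m/n]*n y P) ⟩
    T + (y % P + y / P * P) ≡⟨ sym (+-assoc T (y % P) _) ⟩
    T + y % P + y / P * P   ∎
    where open ≡-Reasoning
  at-residue : Q (T + y % P)
  at-residue = backwards (y / P) (T + y % P) (subst Q split (forwards T t₀ q))

MeetingWindow : ∀ {n k} → PVGraph n k → ℕ → Set
MeetingWindow G L =
  ∀ c c' → ∃[ P ] (1 ≤ P × P ≤ L × (period G c ∣ P) × (period G c' ∣ P))

period-positive : ∀ {n k} (G : PVGraph n k) c → 1 ≤ period G c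
period-positive G c = >-nonZero⁻¹ (period G c) {{period-nz G c}}

period≤sysPeriod : ∀ {n k} (G : PVGraph n k) c → period G c ≤ sysPeriod G
period≤sysPeriod {k = k} G c = ≤-max (allFin k) (∈-allFin c)
  where
  ≤-max : ∀ {A : Set} {f : A → ℕ} (xs : List A) {c} → c ∈ˡ xs → f c ≤ foldr _⊔_ 0 (map f xs)
  ≤-max {f = f} (x ∷ xs) (here refl) = m≤m⊔n (f x) _
  ≤-max {f = f} (x ∷ xs) (there m)   = ≤-trans (≤-max xs m) (m≤n⊔m (f x) _)

-- p² is a meeting window (the product of two periods), and so is p when all
-- periods are equal.
window-square : ∀ {n k} (G : PVGraph n k) → MeetingWindow G (sysPeriod G * sysPeriod G)
window-square G c c' =
  period G c * period G c' , *-mono-≤ (period-positive G c) (period-positive G c')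
  , *-mono-≤ (period≤sysPeriod G c) (period≤sysPeriod G c') , m∣m*n (period G c') , n∣m*n (period G c)

window-homogeneous : ∀ {n k} (G : PVGraph n k) → Homogeneous G → MeetingWindow G (sysPeriod G)
window-homogeneous G hom c c' =
  period G c , period-positive G c , period≤sysPeriod G c , ∣-reflexive refl , ∣-reflexive (sym (hom c c'))

-- A halted state is a fixed point of the step function, so all runs that reach
-- a halted state reach the same one.
step-halted : ∀ {n k} (G : PVGraph n k) pick s → mode s ≡ halted → step G pick s ≡ s
step-halted G pick s eq with mode s | eq
... | .halted | refl = refl

run-halted : ∀ {n k} (G : PVGraph n k) pick b s → mode s ≡ halted → run G pick b s ≡ s
run-halted G pick zero    s _  = refl
run-halted G pick (suc b) s hl rewrite step-halted G pick s hl = run-halted G pick b s hl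

run-+ : ∀ {n k} (G : PVGraph n k) pick a b s → run G pick (a + b) s ≡ run G pick b (run G pick a s)
run-+ G pick zero    b s = refl
run-+ G pick (suc a) b s = run-+ G pick a b (step G pick s)

run-suc : ∀ {n k} (G : PVGraph n k) pick i s → run G pick (suc i) s ≡ step G pick (run G pick i s)
run-suc G pick i s = trans (cong (λ m → run G pick m s) (+-comm 1 i)) (run-+ G pick i 1 s)

halted-unique : ∀ {n k} (G : PVGraph n k) pick a b s →
  mode (run G pick a s) ≡ halted → mode (run G pick b s) ≡ halted → run G pick a s ≡ run G pick b s
halted-unique G pick a b s ha hb = begin
  run G pick a s                 ≡⟨ sym (run-halted G pick b _ ha) ⟩
  run G pick b (run G pick a s)  ≡⟨ sym (run-+ G pick a b s) ⟩
  run G pick (a + b) s           ≡⟨ cong (λ m → run G pick m s) (+-comm a b) ⟩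
  run G pick (b + a) s           ≡⟨ run-+ G pick b a s ⟩
  run G pick a (run G pick b s)  ≡⟨ run-halted G pick a _ hb ⟩
  run G pick b s                 ∎
  where open ≡-Reasoning

module Exploration {n k : ℕ} (G : PVGraph n k) (pick : Pick k) (pick-correct : PickCorrect pick)
  (feasible : Feasible G) (h : Fin k) (g₀ : ℕ) (g₀≥1 : 1 ≤ g₀) (L : ℕ) (window : MeetingWindow G L) where

  State : Set
  State = AgentState n k

  fresh : State → Subset k
  fresh = newCarriers G pick

  Meet : Fin k → Fin k → Set
  Meet a b = ∃[ t ] (pos G a t ≡ pos G b t)

  data Linked : Fin k → Set where
    start : Linked h
    link  : ∀ {a b} → Linked a → Meet b a → Linked b

  data Ancestor (par : Fin k → Maybe (Fin k)) (c : Fin k) : Fin k → Set where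
    self : Ancestor par c c
    via  : ∀ {d q} → par d ≡ just q → Ancestor par c q → Ancestor par c d

  NoFreshAt : State → ℕ → Set
  NoFreshAt s t = ∀ c' → pos G c' t ≡ pos G (cur s) t → c' ∈ encountered s

  Explored : State → Fin k → Set
  Explored s c = (∀ t → pos G c t ∈ visited s) × (∀ c' t → pos G c' t ≡ pos G c t → c' ∈ encountered s)

  -- Initial credit and the cost W g = 2g+3 of exploring and backtracking an edge.
  K : ℕ
  K = 15 * k * g₀

  W : ℕ → ℕ
  W g = 2 * g + 3

  Budget : ℕ → State → (Fin k → ℕ) → ℕ → Set
  Budget i s d x = i + W (guess s) * d (cur s) + 2 * W (guess s) + K
                   ≤ 15 * k * guess s + 2 * W (guess s) * ∣ encountered s ∣ + x

  -- While exploring, u = g - r steps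
  -- were ridden since time T0, none of them meeting a fresh carrier.  While
  -- backtracking, u steps were ridden since time T1 without meeting the parent,
  -- and (once g ≥ L) the current carrier is explored.
  ModeInv : State → (Fin k → ℕ) → ℕ → Mode → Set
  ModeInv s d i procedure = Budget i s d 0
  ModeInv s d i (explore r) = ∃[ u ] (u + r ≡ guess s × Budget i s d (suc u) × ∃[ T0 ] (time s ≡ T0 + u
    × (∀ j → j < u → NoFreshAt s (T0 + j)) × (∀ j → j < u → pos G (cur s) (T0 + suc j) ∈ visited s)))
  ModeInv s d i (backtrack r) = cur s ≢ home s × (L ≤ guess s → Explored s (cur s)) × ∃[ u ] (u + r ≡ guess s
    × Budget i s d (suc (suc (u + guess s))) × ∃[ T1 ] (time s ≡ T1 + u
    × (∀ q → parent s (cur s) ≡ just q → ∀ j → j < u → pos G q (T1 + j) ≢ pos G (cur s) (T1 + j))))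
  ModeInv s d i halted = ⊥

  record Inv (i : ℕ) (s : State) : Set where
    field
      depth       : Fin k → ℕ
      guess≥1     : 1 ≤ guess s
      guess≤      : guess s ≤ g₀ + 2 * L
      moves≤steps : moves s ≤ i
      cur∈        : cur s ∈ encountered s
      home∈       : home s ∈ encountered s
      home-root   : parent s (home s) ≡ nothing
      tree-edge   : ∀ c → c ∈ encountered s → c ≢ home s →
                    ∃[ q ] (parent s c ≡ just q × q ∈ encountered s × depth c ≡ suc (depth q) × Meet c q)
      cur-linked  : Linked (cur s)
      explored-or-ancestor : L ≤ guess s → ∀ c → c ∈ encountered s → Explored s c ⊎ Ancestor (parent s) c (cur s)
      mode-inv    : ModeInv s depth i (mode s)

  open Inv

  -- The step budget of the whole run: 15k·2g for the largest possible guess.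
  step-budget : ℕ
  step-budget = 15 * k * (2 * (g₀ + 2 * L))

  Outcome : ℕ → State → Set
  Outcome i s = (mode s ≡ halted × moves s ≤ step-budget) ⊎ Inv i s

  one≤k : 1 ≤ k
  one≤k = ≤-trans (s≤s z≤n) (toℕ<n h)

  one≤L : 1 ≤ L
  one≤L with window h h
  ... | _ , P≥1 , P≤L , _ = ≤-trans P≥1 P≤L

  prefix≤ : ∀ {u r g} → u + r ≡ g → u ≤ g
  prefix≤ {u} {r} e = subst (u ≤_) e (m≤m+n u r)

  fresh-member : ∀ s c' → c' ∈ fresh s → pos G c' (time s) ≡ pos G (cur s) (time s) × c' ∉ encountered s
  fresh-member s c' mem with pos G c' (time s) ≟ᶠ pos G (cur s) (time s) | c' ∈? encountered s
                           | trans (sym (lookup∘tabulate _ c')) ([]=⇒lookup mem)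
  ... | yes e | no ne | _ = e , ne
  ... | yes e | yes _ | ()
  ... | no _  | _     | ()

  no-fresh : ∀ s → ¬ Nonempty (fresh s) → NoFreshAt s (time s)
  no-fresh s none c' e with c' ∈? encountered s
  ... | yes m = m
  ... | no nm = ⊥-elim (none (c' , lookup⇒[]= c' _ (trans (lookup∘tabulate _ c') is-fresh)))
    where
    is-fresh : (⌊ pos G c' (time s) ≟ᶠ pos G (cur s) (time s) ⌋ ∧ not ⌊ c' ∈? encountered s ⌋) ≡ true
    is-fresh with pos G c' (time s) ≟ᶠ pos G (cur s) (time s) | c' ∈? encountered s
    ... | yes _ | no _  = refl
    ... | no ¬e | _     = ⊥-elim (¬e e)
    ... | yes _ | yes m = ⊥-elim (nm m)

  explored-mono : ∀ {s s' c} → Explored s c → visited s ⊆ visited s' → encountered s ⊆ encountered s' →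
    Explored s' c
  explored-mono (sites , partners) vs es = (λ t → vs (sites t)) , λ c' t p → es (partners c' t p)

  meets-within : ∀ a b t → pos G a t ≡ pos G b t → ∀ T → ∃[ j ] (j < L × pos G a (T + j) ≡ pos G b (T + j))
  meets-within a b t e T with window a b
  ... | P , P≥1 , P≤L , da , db with periodic-window (λ t → pos G a t ≡ pos G b t) P P≥1
        (λ t e → trans (pos-shift G a t P da) (trans e (sym (pos-shift G b t P db))))
        (λ t e → trans (sym (pos-shift G a t P da)) (trans e (pos-shift G b t P db))) t e T
  ... | j , j<P , q = j , ≤-trans j<P P≤L , q

  returns-within : ∀ a t T → ∃[ j ] (j < L × pos G a (T + j) ≡ pos G a t)
  returns-within a t T with window a a
  ... | P , P≥1 , P≤L , da , _ with periodic-window (λ t' → pos G a t' ≡ pos G a t) P P≥1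
        (λ t' e → trans (pos-shift G a t' P da) e) (λ t' e → trans (sym (pos-shift G a t' P da)) e) t refl T
  ... | j , j<P , q = j , ≤-trans j<P P≤L , q

  explored-by-ride : ∀ s T0 → L ≤ guess s → (∀ j → j < guess s → NoFreshAt s (T0 + j)) →
    (∀ j → j < guess s → pos G (cur s) (T0 + suc j) ∈ visited s) → Explored s (cur s)
  explored-by-ride s T0 Lg quiet seen = sites , partners
    where
    sites : ∀ t → pos G (cur s) t ∈ visited s
    sites t with returns-within (cur s) t (suc T0)
    ... | j , j<L , q = subst (_∈ visited s) (trans (cong (pos G (cur s)) (+-suc T0 j)) q) (seen j (≤-trans j<L Lg))
    partners : ∀ c' t → pos G c' t ≡ pos G (cur s) t → c' ∈ encountered s
    partners c' t e with meets-within c' (cur s) t e T0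
    ... | j , j<L , q = quiet j (≤-trans j<L Lg) c' q

  budget-slack : ∀ {i s} (inv : Inv i s) → ∃[ x ] (x ≤ suc (suc (guess s + guess s)) × Budget i s (depth inv) x)
  budget-slack {i} {s} inv with mode s | mode-inv inv
  ... | procedure   | b = 0 , z≤n , b
  ... | explore r   | u , eu , b , _ = suc u , s≤s (≤-trans (prefix≤ eu) (≤-trans (m≤m+n _ _) (n≤1+n _))) , b
  ... | backtrack r | _ , _ , u , eu , b , _ =
    suc (suc (u + guess s)) , s≤s (s≤s (+-monoˡ-≤ (guess s) (prefix≤ eu))) , b
  ... | halted      | ()

  steps-bound : ∀ {i s} → Inv i s → suc i + K ≤ 15 * k * (2 * guess s)
  steps-bound {i} {s} inv with budget-slack inv
  ... | x , x≤ , b = budget-exhausted {i} {depth inv (cur s)} {2 * W (guess s)} {K} {∣ encountered s ∣} {x} {guess s} {k}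
                       b (∣p∣≤n (encountered s)) x≤ (guess≥1 inv) one≤k

  -- Since the guess never exceeds g₀ + 2L, steps and moves stay below step-budget.
  steps<budget : ∀ {i s} → Inv i s → i < step-budget
  steps<budget {i} {s} inv = ≤-trans (≤-trans (m≤m+n (suc i) K) (steps-bound inv))
                               (*-monoʳ-≤ (15 * k) (*-monoʳ-≤ 2 (guess≤ inv)))

  moves-within : ∀ {i s} → Inv i s → moves s ≤ step-budget
  moves-within inv = ≤-trans (moves≤steps inv) (<⇒≤ (steps<budget inv))

  singleton-root : ∀ x {c} → c ∈ ⁅ x ⁆ → Ancestor (λ _ → nothing) c x
  singleton-root x m = subst (λ c → Ancestor (λ _ → nothing) c x) (sym (x∈⁅y⁆⇒x≡y x m)) self

  -- A restart while g < L doubles the guess, keeping it below g₀ + 2L.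
  restart-preserves : ∀ {i s} → Inv i s → ¬ (L ≤ guess s) → Inv (suc i) (restart G pick s)
  restart-preserves {i} {s} inv g≱L = record
    { depth = λ _ → 0
    ; guess≥1 = ≤-trans (guess≥1 inv) (m≤m+n (guess s) _)
    ; guess≤ = ≤-trans (*-monoʳ-≤ 2 (<⇒≤ (≰⇒> g≱L))) (m≤n+m (2 * L) g₀)
    ; moves≤steps = ≤-trans (moves≤steps inv) (n≤1+n i)
    ; cur∈ = x∈⁅x⁆ (cur s)
    ; home∈ = x∈⁅x⁆ (cur s)
    ; home-root = refl
    ; tree-edge = λ c m c≢ → ⊥-elim (c≢ (x∈⁅y⁆⇒x≡y (cur s) m))
    ; cur-linked = cur-linked inv
    ; explored-or-ancestor = λ _ c m → inj₂ (singleton-root (cur s) m)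
    ; mode-inv = subst (λ e → suc i + W g' * 0 + 2 * W g' + K ≤ 15 * k * g' + 2 * W g' * e + 0)
                   (sym (∣⁅x⁆∣≡1 (cur s))) (budget-restart {suc i} {K} (W g') (steps-bound inv))
    }
    where
    g' : ℕ
    g' = 2 * guess s

  after-procedure : ∀ {i s} → Inv i s → mode s ≡ procedure → Inv (suc i) (record s { mode = explore (guess s) })
  after-procedure {i} {s} inv eq = record
    { depth = depth inv ; guess≥1 = guess≥1 inv ; guess≤ = guess≤ inv
    ; moves≤steps = ≤-trans (moves≤steps inv) (n≤1+n i)
    ; cur∈ = cur∈ inv ; home∈ = home∈ inv ; home-root = home-root inv ; tree-edge = tree-edge inv
    ; cur-linked = cur-linked inv ; explored-or-ancestor = explored-or-ancestor inv
    ; mode-inv = 0 , refl , budget-tick {x = 0} (subst (ModeInv s (depth inv) i) eq (mode-inv inv)) (s≤s z≤n)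
               , time s , sym (+-identityʳ _) , (λ j ()) , (λ j ())
    }

  after-explore-move : ∀ {i s r} → Inv i s → mode s ≡ explore (suc r) → ¬ Nonempty (fresh s) →
    Inv (suc i) (moveOn G pick s (explore r))
  after-explore-move {i} {s} {r} inv eq none with subst (ModeInv s (depth inv) i) eq (mode-inv inv)
  ... | u , eu , b , T0 , tE , quiet , seen = record
    { depth = depth inv ; guess≥1 = guess≥1 inv ; guess≤ = guess≤ inv ; moves≤steps = s≤s (moves≤steps inv)
    ; cur∈ = cur∈ inv ; home∈ = home∈ inv ; home-root = home-root inv ; tree-edge = tree-edge inv
    ; cur-linked = cur-linked inv
    ; explored-or-ancestor = λ Lg c m → keep (explored-or-ancestor inv Lg c m)
    ; mode-inv = suc u , trans (sym (+-suc u r)) eu , budget-tick {x = suc u} b ≤-refl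
               , T0 , trans (cong suc tE) (sym (+-suc T0 u)) , quiet' , seen'
    }
    where
    s' : State
    s' = moveOn G pick s (explore r)
    keep : ∀ {c} → Explored s c ⊎ Ancestor (parent s) c (cur s) → Explored s' c ⊎ Ancestor (parent s) c (cur s)
    keep (inj₁ ex) = inj₁ (explored-mono {s} {s'} ex (p⊆p∪q _) (λ x → x))
    keep (inj₂ an) = inj₂ an
    quiet' : ∀ j → j < suc u → NoFreshAt s' (T0 + j)
    quiet' j j< with m<1+n⇒m<n∨m≡n j<
    ... | inj₁ j<u  = quiet j j<u
    ... | inj₂ refl = subst (NoFreshAt s) tE (no-fresh s none)
    seen' : ∀ j → j < suc u → pos G (cur s) (T0 + suc j) ∈ visited s'
    seen' j j< with m<1+n⇒m<n∨m≡n j<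
    ... | inj₁ j<u  = p⊆p∪q _ (seen j j<u)
    ... | inj₂ refl = subst (λ t → pos G (cur s) t ∈ visited s') (trans (cong suc tE) (sym (+-suc T0 u)))
                        (q⊆p∪q (visited s) _ (x∈⁅x⁆ _))

  if-≢ : ∀ {A : Set} (x c' : Fin k) (a b : A) → x ≢ c' → (if ⌊ x ≟ᶠ c' ⌋ then a else b) ≡ b
  if-≢ x c' a b ne with x ≟ᶠ c'
  ... | yes e = ⊥-elim (ne e)
  ... | no _  = refl

  if-≡ : ∀ {A : Set} (c' : Fin k) (a b : A) → (if ⌊ c' ≟ᶠ c' ⌋ then a else b) ≡ a
  if-≡ c' a b with c' ≟ᶠ c'
  ... | yes _ = refl
  ... | no ne = ⊥-elim (ne refl)

  -- Switching to a fresh carrier c' met at the current time hangs c' below the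
  -- current carrier in the tree; the old tree and its ancestor chains survive.
  module Switch {i s} (inv : Inv i s) (c' : Fin k)
    (meet : pos G c' (time s) ≡ pos G (cur s) (time s)) (c'∉ : c' ∉ encountered s) where

    enc : Subset k
    enc = encountered s

    s' : State
    s' = switchNew G pick s c'

    depth' : Fin k → ℕ
    depth' x = if ⌊ x ≟ᶠ c' ⌋ then suc (depth inv (cur s)) else depth inv x

    old≢new : ∀ {x} → x ∈ enc → x ≢ c'
    old≢new xm e = c'∉ (subst (_∈ enc) e xm)

    tree-edge' : ∀ c → c ∈ encountered s' → c ≢ home s' →
      ∃[ q ] (parent s' c ≡ just q × q ∈ encountered s' × depth' c ≡ suc (depth' q) × Meet c q)
    tree-edge' c m nh with x∈p∪q⁻ enc ⁅ c' ⁆ m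
    ... | inj₁ cm with tree-edge inv c cm nh
    ...   | q , pq , qm , dq , mt = q , trans (if-≢ c c' _ _ (old≢new cm)) pq , p⊆p∪q _ qm
          , trans (if-≢ c c' _ _ (old≢new cm)) (trans dq (cong suc (sym (if-≢ q c' _ _ (old≢new qm))))) , mt
    tree-edge' c m nh | inj₂ cc with x∈⁅y⁆⇒x≡y c' cc
    ... | refl = cur s , if-≡ c' _ _ , p⊆p∪q _ (cur∈ inv)
               , trans (if-≡ c' _ _) (cong suc (sym (if-≢ (cur s) c' _ _ (old≢new (cur∈ inv))))) , (time s , meet)

    -- Parents of encountered carriers are encountered, so ancestor chains
    -- inside the old tree are unaffected by the new pointer.
    parent-encountered : ∀ {x q} → x ∈ enc → parent s x ≡ just q → q ∈ enc
    parent-encountered {x} xm px with x ≟ᶠ home s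
    ... | yes xh with trans (sym px) (trans (cong (parent s) xh) (home-root inv))
    ...   | ()
    parent-encountered {x} xm px | no nh with tree-edge inv x xm nh
    ... | q' , pq' , qm' , _ = subst (_∈ enc) (just-injective (trans (sym pq') px)) qm'

    ancestor-transfer : ∀ {c x} → Ancestor (parent s) c x → x ∈ enc → Ancestor (parent s') c x
    ancestor-transfer self _ = self
    ancestor-transfer {x = x} (via px an) xm =
      via (trans (if-≢ x c' _ _ (old≢new xm)) px) (ancestor-transfer an (parent-encountered xm px))

    explored-or-ancestor' : L ≤ guess s → ∀ c → c ∈ encountered s' →
      Explored s' c ⊎ Ancestor (parent s') c (cur s')
    explored-or-ancestor' Lg c m with x∈p∪q⁻ enc ⁅ c' ⁆ m
    ... | inj₂ cc = inj₂ (subst (λ z → Ancestor (parent s') z c') (sym (x∈⁅y⁆⇒x≡y c' cc)) self)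
    ... | inj₁ cm with explored-or-ancestor inv Lg c cm
    ...   | inj₁ ex = inj₁ (explored-mono {s} {s'} ex (λ x → x) (p⊆p∪q _))
    ...   | inj₂ an = inj₂ (via (if-≡ c' _ _) (ancestor-transfer an (cur∈ inv)))

  after-switch : ∀ {i s r} → Inv i s → mode s ≡ explore r → (ne : Nonempty (fresh s)) →
    Inv (suc i) (switchNew G pick s (pick (fresh s) ne))
  after-switch {i} {s} {r} inv eq ne with subst (ModeInv s (depth inv) i) eq (mode-inv inv)
  ... | u , eu , b , _ = record
    { depth = depth' ; guess≥1 = guess≥1 inv ; guess≤ = guess≤ inv
    ; moves≤steps = ≤-trans (moves≤steps inv) (n≤1+n i)
    ; cur∈ = q⊆p∪q enc ⁅ c' ⁆ (x∈⁅x⁆ c')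
    ; home∈ = p⊆p∪q ⁅ c' ⁆ (home∈ inv)
    ; home-root = trans (if-≢ (home s) c' _ _ (old≢new (home∈ inv))) (home-root inv)
    ; tree-edge = tree-edge'
    ; cur-linked = link (cur-linked inv) (time s , meet)
    ; explored-or-ancestor = explored-or-ancestor'
    ; mode-inv = budget-descend {i} {depth inv (cur s)} {depth' c'} {2 * W (guess s)} {K} {15 * k * guess s}
                   {∣ enc ∣} {∣ enc ∪ ⁅ c' ⁆ ∣} {suc u} {W (guess s)}
                   b (if-≡ c' _ _) (explore-slack (prefix≤ eu))
                   (p⊂q⇒∣p∣<∣q∣ (p⊆p∪q _ , c' , q⊆p∪q enc ⁅ c' ⁆ (x∈⁅x⁆ c') , c'∉))
    }
    where
    c' : Fin k
    c' = pick (fresh s) ne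
    meet : pos G c' (time s) ≡ pos G (cur s) (time s)
    meet = proj₁ (fresh-member s c' (pick-correct (fresh s) ne))
    c'∉ : c' ∉ encountered s
    c'∉ = proj₂ (fresh-member s c' (pick-correct (fresh s) ne))
    open Switch inv c' meet c'∉

  ancestor-of-root : ∀ {par : Fin k → Maybe (Fin k)} {c x} → Ancestor par c x → par x ≡ nothing → c ≡ x
  ancestor-of-root self _ = refl
  ancestor-of-root (via p _) pn with trans (sym p) pn
  ... | ()

  AllExplored : State → Set
  AllExplored s = ∀ c → c ∈ encountered s → Explored s c

  -- Once g ≥ L, if the current carrier is Home and explored, so is every
  -- encountered carrier (its only ancestor is Home itself).
  all-explored : ∀ {i s} → Inv i s → L ≤ guess s → cur s ≡ home s → Explored s (cur s) → AllExplored s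
  all-explored {i} {s} inv Lg ch ex c m with explored-or-ancestor inv Lg c m
  ... | inj₁ exc = exc
  ... | inj₂ an  = subst (Explored s) (sym (ancestor-of-root an (trans (cong (parent s) ch) (home-root inv)))) ex

  -- If all encountered carriers are explored, Encountered is closed under
  -- meetings, hence contains the start carrier h.
  start-encountered : ∀ {s b} → AllExplored s → Linked b → b ∈ encountered s → h ∈ encountered s
  start-encountered done start m = m
  start-encountered {s} {b} done (link {a} la (t , e)) m = start-encountered {s} done la (proj₂ (done b m) a t (sym e))

  -- Every site on a valid walk that starts on an encountered carrier lies on
  -- an explored route, hence is visited; by feasibility every site is visited.
  all-sites-visited : ∀ s → AllExplored s → h ∈ encountered s → ∀ z → z ∈ visited s
  all-sites-visited s done h∈ z with feasible h
  ... | cs , valid , covers = walk (pos G h 0) 0 cs (h , h∈ , refl) valid z (covers z)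
    where
    walk : ∀ y t cs → ∃[ e ] (e ∈ encountered s × pos G e t ≡ y) → ValidMoves G y t cs →
           ∀ z → z ∈ˡ visits G y t cs → z ∈ visited s
    walk y t []       (e , em , ey) _ z (here zy) = subst (_∈ visited s) (trans ey (sym zy)) (proj₁ (done e em) t)
    walk y t (_ ∷ _)  (e , em , ey) _ z (here zy) = subst (_∈ visited s) (trans ey (sym zy)) (proj₁ (done e em) t)
    walk y t []       _ _ z (there ())
    walk y t (c ∷ cs) (e , em , ey) (pc , vm) z (there zm) =
      walk (pos G c (suc t)) (suc t) cs (c , proj₂ (done e em) c t (trans pc (sym ey)) , refl) vm z zm

  home-phase-complete : ∀ {i s} → Inv i s → L ≤ guess s → cur s ≡ home s → Explored s (cur s) →
    allVisited G pick s ≡ true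
  home-phase-complete {i} {s} inv Lg ch ex with ∣ visited s ∣ ≟ n
  ... | yes _ = refl
  ... | no ne = ⊥-elim (ne (trans (cong ∣_∣ everything) (∣⊤∣≡n n)))
    where
    done : AllExplored s
    done = all-explored inv Lg ch ex
    everything : visited s ≡ ⊤
    everything = ⊆-antisym ⊆⊤ (λ {x} _ →
      all-sites-visited s done (start-encountered {s} done (cur-linked inv) (cur∈ inv)) x)

  explore-end-explored : ∀ {i s} → Inv i s → mode s ≡ explore 0 → L ≤ guess s → Explored s (cur s)
  explore-end-explored {i} {s} inv eq Lg with subst (ModeInv s (depth inv) i) eq (mode-inv inv)
  ... | u , eu , _ , T0 , _ , quiet , seen with trans (sym (+-identityʳ u)) eu
  ... | refl = explored-by-ride s T0 Lg quiet seen

  after-explore-end-away : ∀ {i s} → Inv i s → mode s ≡ explore 0 → cur s ≢ home s →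
    Inv (suc i) (record s { mode = backtrack (guess s) })
  after-explore-end-away {i} {s} inv eq ch with subst (ModeInv s (depth inv) i) eq (mode-inv inv)
  ... | u , eu , b , _ = record
    { depth = depth inv ; guess≥1 = guess≥1 inv ; guess≤ = guess≤ inv
    ; moves≤steps = ≤-trans (moves≤steps inv) (n≤1+n i)
    ; cur∈ = cur∈ inv ; home∈ = home∈ inv ; home-root = home-root inv ; tree-edge = tree-edge inv
    ; cur-linked = cur-linked inv ; explored-or-ancestor = explored-or-ancestor inv
    ; mode-inv = ch , explore-end-explored inv eq , 0 , refl
               , budget-tick {x = suc u} b (s≤s (s≤s (≤-reflexive (trans (sym (+-identityʳ u)) eu))))
               , time s , sym (+-identityʳ _) , (λ q _ j ())
    }

  -- At the end of the Home ride the agent halts, or restarts with g < L.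
  after-explore-end-home : ∀ {i s} → Inv i s → mode s ≡ explore 0 → cur s ≡ home s →
    Outcome (suc i) (if allVisited G pick s then record s { mode = halted } else restart G pick s)
  after-explore-end-home {i} {s} inv eq ch with allVisited G pick s in av
  ... | true  = inj₁ (refl , moves-within inv)
  ... | false = inj₂ (restart-preserves inv λ Lg →
                  case-false (trans (sym av) (home-phase-complete inv Lg ch (explore-end-explored inv eq Lg))))
    where
    case-false : false ≢ true
    case-false ()

  -- A fresh carrier while backtracking: impossible once g ≥ L, since the
  -- current carrier is then explored.
  after-backtrack-fresh : ∀ {i s r} → Inv i s → mode s ≡ backtrack r → Nonempty (fresh s) →
    Inv (suc i) (restart G pick s)
  after-backtrack-fresh {i} {s} {r} inv eq (c' , mem) = restart-preserves inv λ Lg →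
    let meet , c'∉ = fresh-member s c' mem
        _ , ex , _ = subst (ModeInv s (depth inv) i) eq (mode-inv inv)
    in c'∉ (proj₂ (ex Lg) c' (time s) meet)

  -- The backtracking carrier is not Home, so it has a parent.
  backtrack-has-parent : ∀ {i s r} → Inv i s → mode s ≡ backtrack r → parent s (cur s) ≢ nothing
  backtrack-has-parent {i} {s} inv eq pn with subst (ModeInv s (depth inv) i) eq (mode-inv inv)
  ... | ch , _ with tree-edge inv (cur s) (cur∈ inv) ch
  ...   | q , pq , _ with trans (sym pq) pn
  ...     | ()

  after-backtrack-return : ∀ {i s r q} → Inv i s → mode s ≡ backtrack r → parent s (cur s) ≡ just q →
    Inv (suc i) (record s { cur = q ; mode = procedure })
  after-backtrack-return {i} {s} {r} {q} inv eq pq with subst (ModeInv s (depth inv) i) eq (mode-inv inv)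
  ... | ch , ex , u , eu , b , _ with tree-edge inv (cur s) (cur∈ inv) ch
  ...   | q' , pq' , qm , dq , (t , mt) with just-injective (trans (sym pq) pq')
  ...     | refl = record
    { depth = depth inv ; guess≥1 = guess≥1 inv ; guess≤ = guess≤ inv
    ; moves≤steps = ≤-trans (moves≤steps inv) (n≤1+n i)
    ; cur∈ = qm ; home∈ = home∈ inv ; home-root = home-root inv ; tree-edge = tree-edge inv
    ; cur-linked = link (cur-linked inv) (t , sym mt)
    ; explored-or-ancestor = explored-or-ancestor'
    ; mode-inv = budget-ascend {i} {depth inv (cur s)} {depth inv q} {2 * W (guess s)} {K} {15 * k * guess s}
                   {∣ encountered s ∣} {suc (suc (u + guess s))} {W (guess s)} b dq (backtrack-slack (prefix≤ eu))
    }
    where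
    explored-or-ancestor' : L ≤ guess s → ∀ c → c ∈ encountered s →
      Explored s c ⊎ Ancestor (parent s) c q
    explored-or-ancestor' Lg c m with explored-or-ancestor inv Lg c m
    ... | inj₁ exc        = inj₁ exc
    ... | inj₂ self       = inj₁ (ex Lg)
    ... | inj₂ (via p an) = inj₂ (subst (Ancestor (parent s) c) (just-injective (trans (sym p) pq)) an)

  after-backtrack-move : ∀ {i s r q} → Inv i s → mode s ≡ backtrack (suc r) → ¬ Nonempty (fresh s) →
    parent s (cur s) ≡ just q → pos G q (time s) ≢ pos G (cur s) (time s) → Inv (suc i) (moveOn G pick s (backtrack r))
  after-backtrack-move {i} {s} {r} {q} inv eq none pq apart with subst (ModeInv s (depth inv) i) eq (mode-inv inv)
  ... | ch , ex , u , eu , b , T1 , tE , missed = record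
    { depth = depth inv ; guess≥1 = guess≥1 inv ; guess≤ = guess≤ inv ; moves≤steps = s≤s (moves≤steps inv)
    ; cur∈ = cur∈ inv ; home∈ = home∈ inv ; home-root = home-root inv ; tree-edge = tree-edge inv
    ; cur-linked = cur-linked inv
    ; explored-or-ancestor = λ Lg c m → keep (explored-or-ancestor inv Lg c m)
    ; mode-inv = ch , (λ Lg → explored-mono {s} {s'} (ex Lg) (p⊆p∪q _) (λ x → x)) , suc u , trans (sym (+-suc u r)) eu
               , budget-tick {x = suc (suc (u + guess s))} b ≤-refl
               , T1 , trans (cong suc tE) (sym (+-suc T1 u)) , missed'
    }
    where
    s' : State
    s' = moveOn G pick s (backtrack r)
    keep : ∀ {c} → Explored s c ⊎ Ancestor (parent s) c (cur s) → Explored s' c ⊎ Ancestor (parent s) c (cur s)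
    keep (inj₁ exc) = inj₁ (explored-mono {s} {s'} exc (p⊆p∪q _) (λ x → x))
    keep (inj₂ an)  = inj₂ an
    missed' : ∀ q' → parent s (cur s) ≡ just q' → ∀ j → j < suc u → pos G q' (T1 + j) ≢ pos G (cur s) (T1 + j)
    missed' q' pq' j j< with m<1+n⇒m<n∨m≡n j< | just-injective (trans (sym pq) pq')
    ... | inj₁ j<u  | _    = missed q' pq' j j<u
    ... | inj₂ refl | refl = subst (λ t → pos G q t ≢ pos G (cur s) t) tE apart

  -- A backtracking ride of g ≥ L steps always meets the parent, so running out
  -- of time forces g < L.
  after-backtrack-timeout : ∀ {i s q} → Inv i s → mode s ≡ backtrack 0 → parent s (cur s) ≡ just q →
    pos G q (time s) ≢ pos G (cur s) (time s) → Inv (suc i) (restart G pick s)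
  after-backtrack-timeout {i} {s} {q} inv eq pq apart = restart-preserves inv parent-met
    where
    parent-met : ¬ (L ≤ guess s)
    parent-met Lg with subst (ModeInv s (depth inv) i) eq (mode-inv inv)
    ... | ch , _ , u , eu , _ , T1 , tE , missed with trans (sym (+-identityʳ u)) eu | tree-edge inv (cur s) (cur∈ inv) ch
    ...   | refl | q' , pq' , _ , _ , (t , mt) with just-injective (trans (sym pq) pq')
    ...     | refl with meets-within q (cur s) t (sym mt) T1
    ...       | j , j<L , e = missed q pq j (≤-trans j<L Lg) e

  step-preserves : ∀ i s → Inv i s → Outcome (suc i) (step G pick s)
  step-preserves i s inv with mode s in eq
  ... | halted    = ⊥-elim (subst (ModeInv s (depth inv) i) eq (mode-inv inv))
  ... | procedure with allVisited G pick s
  ...   | true  = inj₁ (refl , moves-within inv)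
  ...   | false = inj₂ (after-procedure inv eq)
  step-preserves i s inv | explore r with nonempty? (fresh s)
  ...   | yes ne = inj₂ (after-switch inv eq ne)
  ...   | no none with r
  ...     | suc r' = inj₂ (after-explore-move inv eq none)
  ...     | zero with cur s ≟ᶠ home s
  ...       | yes ch = after-explore-end-home inv eq ch
  ...       | no ¬ch = inj₂ (after-explore-end-away inv eq ¬ch)
  step-preserves i s inv | backtrack r with nonempty? (fresh s)
  ...   | yes ne = inj₂ (after-backtrack-fresh inv eq ne)
  ...   | no none with parent s (cur s) in ep
  ...     | nothing = ⊥-elim (backtrack-has-parent inv eq ep)
  ...     | just q with pos G q (time s) ≟ᶠ pos G (cur s) (time s)
  ...       | yes _ = inj₂ (after-backtrack-return inv eq ep)
  ...       | no apart with r
  ...         | suc r' = inj₂ (after-backtrack-move inv eq none ep apart)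
  ...         | zero   = inj₂ (after-backtrack-timeout inv eq ep apart)

  s₀ : State
  s₀ = initial G pick g₀ h

  initial-inv : Inv 0 s₀
  initial-inv = record
    { depth = λ _ → 0 ; guess≥1 = g₀≥1 ; guess≤ = m≤m+n g₀ _ ; moves≤steps = z≤n
    ; cur∈ = x∈⁅x⁆ h ; home∈ = x∈⁅x⁆ h ; home-root = refl
    ; tree-edge = λ c m c≢ → ⊥-elim (c≢ (x∈⁅y⁆⇒x≡y h m))
    ; cur-linked = start
    ; explored-or-ancestor = λ _ c m → inj₂ (singleton-root h m)
    ; mode-inv = subst (λ e → 0 + W g₀ * 0 + 2 * W g₀ + K ≤ K + 2 * W g₀ * e + 0) (sym (∣⁅x⁆∣≡1 h))
                   (budget-restart {0} {K} (W g₀) ≤-refl)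
    }

  run-outcome : ∀ i → Outcome i (run G pick i s₀)
  run-outcome zero = inj₂ initial-inv
  run-outcome (suc i) with run-outcome i
  ... | inj₁ (hl , mb) = subst (Outcome (suc i)) (sym (trans (run-suc G pick i s₀) (step-halted G pick _ hl)))
                           (inj₁ (hl , mb))
  ... | inj₂ inv       = subst (Outcome (suc i)) (sym (run-suc G pick i s₀)) (step-preserves i _ inv)

  -- The invariant forces i < step-budget, so after step-budget steps the run
  -- has halted, having made at most step-budget ≤ 30(g₀+2)·k·L moves.
  halts-within : ∃[ N ] (IsHalted (run G pick N s₀) × moves (run G pick N s₀) ≤ 30 * (g₀ + 2) * k * L)
  halts-within with run-outcome step-budget
  ... | inj₁ (hl , mb) = step-budget , hl , ≤-trans mb (final-budget {k} {g₀} one≤L)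
  ... | inj₂ inv       = ⊥-elim (<-irrefl refl (steps<budget inv))

exploration-bound : ∀ {g₀ n k L} → 1 ≤ g₀ → (G : PVGraph n k) (pick : Pick k) → PickCorrect pick →
  Feasible G → (h : Fin k) → MeetingWindow G L →
  ∃[ N ] (IsHalted (run G pick N (initial G pick g₀ h))
          × moves (run G pick N (initial G pick g₀ h)) ≤ 30 * (g₀ + 2) * k * L)
exploration-bound {g₀} {L = L} g₀≥1 G pick ok feas h window =
  Exploration.halts-within G pick ok feas h g₀ g₀≥1 L window

theorem13 : (g₀ : ℕ) → 1 ≤ g₀ →
    ∃[ C ] (∀ {n k} (G : PVGraph n k) (pick : Pick k) → PickCorrect pick →
      Feasible G → (h : Fin k) →
      ∃[ N ] (IsHalted (run G pick N (initial G pick g₀ h))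
        × moves (run G pick N (initial G pick g₀ h)) ≤ C * k * (sysPeriod G * sysPeriod G)
        × (Homogeneous G → moves (run G pick N (initial G pick g₀ h)) ≤ C * k * sysPeriod G)))
theorem13 g₀ g₀≥1 = 30 * (g₀ + 2) , bounds
  where
  bounds : ∀ {n k} (G : PVGraph n k) (pick : Pick k) → PickCorrect pick → Feasible G → (h : Fin k) →
    ∃[ N ] (IsHalted (run G pick N (initial G pick g₀ h))
      × moves (run G pick N (initial G pick g₀ h)) ≤ 30 * (g₀ + 2) * k * (sysPeriod G * sysPeriod G)
      × (Homogeneous G → moves (run G pick N (initial G pick g₀ h)) ≤ 30 * (g₀ + 2) * k * sysPeriod G))
  bounds {k = k} G pick ok feas h with exploration-bound g₀≥1 G pick ok feas h (window-square G)
  ... | N , halts , within-p² = N , halts , within-p² , within-p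
    where
    -- For homogeneous graphs the window p gives a run halting within O(k·p)
    -- moves; it halts in the same state as the run above.
    within-p : Homogeneous G → moves (run G pick N (initial G pick g₀ h)) ≤ 30 * (g₀ + 2) * k * sysPeriod G
    within-p hom with exploration-bound g₀≥1 G pick ok feas h (window-homogeneous G hom)
    ... | N' , halts' , bound = subst (λ s → moves s ≤ 30 * (g₀ + 2) * k * sysPeriod G)
                                  (halted-unique G pick N' N (initial G pick g₀ h) halts' halts) bound
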